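{- Let $q\geq 1$ and $t\geq 0$ be integers and let $r=2^{q}(2t+1)$. If $n\geq 2^{q}(2^{q}-1)r$, then there exists an odd-colorable $r$-graph $G$ on $n$ vertices with $\chi(G)=2^{q}$ (indeed, a family of such $r$-graphs).
   Context: An $r$-graph $G=(V(G),E(G))$ is an $r$-uniform hypergraph: a finite vertex set together with a set of edges, each edge being a subset of $V(G)$ of exactly $r$ vertices. Write $[n]=\{1,\dots,n\}$. For even $r\geq 2$, an $r$-graph $G$ with $V(G)=[n]$ is called odd-colorable if there exists a map $\varphi:[n]\to[r]$ such that for every edge $\{j_1,\dots,j_r\}$ of $G$ one has $\varphi(j_1)+\cdots+\varphi(j_r)\equiv r/2 \pmod r$. An $r$-graph is $k$-chromatic if its vertex set can be partitioned into $k$ sets so that every edge intersects at least two of these sets; the chromatic number $\chi(G)$ is the smallest such $k$. -}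

module Defs where

open import Data.Nat using (ℕ; zero; suc; _+_; _*_; _^_; _<_; _≥_; _/_; _%_)
open import Data.Fin using (Fin; toℕ) renaming (zero to fzero; suc to fsuc)
open import Data.Fin.Subset using (Subset; _∈_; ∣_∣)
open import Data.Bool using (Bool; true; false)
open import Data.Vec using (Vec; []; _∷_)
open import Data.List using (List)
open import Data.List.Relation.Unary.All using (All)
open import Data.Product using (Σ; _×_; ∃; ∃-syntax)
open import Relation.Binary.PropositionalEquality using (_≡_)
open import Relation.Nullary using (¬_)

record Graph (r n : ℕ) : Set where
  field
    edges    : List (Subset n)
    uniform  : All (λ e → ∣ e ∣ ≡ r) edges
open Graph public

subsetSum : ∀ {n} → Subset n → (Fin n → ℕ) → ℕ
subsetSum {zero}  []            w = 0
subsetSum {suc n} (true  ∷ s)   w = w fzero + subsetSum s (λ i → w (fsuc i))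
subsetSum {suc n} (false ∷ s)   w = subsetSum s (λ i → w (fsuc i))

CongMod : ℕ → ℕ → ℕ → Set
CongMod a b m = ∃[ x ] ∃[ y ] (a + x * m ≡ b + y * m)

-- Odd-colorable: φ : [n] → [r] (Fin r, value i stands for i+1) with
-- φ(j₁)+…+φ(j_r) ≡ r/2 (mod r) for every edge.
OddColorable : ∀ {r n} → Graph r n → Set
OddColorable {r} {n} G =
  Σ (Fin n → Fin r) λ φ →
    All (λ e → CongMod (subsetSum e (λ j → suc (toℕ (φ j)))) (r / 2) r)
        (edges G)

Colorable : ∀ {r n} → Graph r n → ℕ → Set
Colorable {r} {n} G k =
  Σ (Fin n → Fin k) λ c →
    All (λ e → ∃[ i ] ∃[ j ] (i ∈ e × j ∈ e × ¬ (c i ≡ c j))) (edges G)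

ChromaticNumber : ∀ {r n} → Graph r n → ℕ → Set
ChromaticNumber G k = Colorable G k × (∀ m → m < k → ¬ Colorable G m)

-- Let P = 2^q and r = PT with T odd. Give vertex v the color φ(v) = kT, where k = v mod P, and take
-- as edges all r-sets on which the values φ + 1 sum to r/2 mod r, so that φ is an odd coloring.
-- Coloring by residue class is proper, since on a monochromatic r-set these values sum to 0 mod r.
-- Given fewer than P colors, each residue class (at least (P − 1)r vertices) contains r vertices of
-- one color, and two classes k₁ < k₂ share that color. Choosing a ≤ P/2 with a(k₂ − k₁) ≡ P/2
-- (mod P), a vertices of class k₂ and r − a of class k₁ form a monochromatic edge.
module Submission where

open import Data.Bool using (true; false)
open import Data.Bool.Properties using (T-≡)
open import Data.Empty using (⊥-elim)
open import Data.Fin using (Fin; toℕ; fromℕ<) renaming (zero to fzero; suc to fsuc)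
import Data.Fin.Properties as Finₚ
open import Data.Fin.Subset using (Subset; _∈_; _∉_; _⊆_; ∣_∣; _∩_; _∪_; ∁; _-_; ⊥; Nonempty)
open import Data.Fin.Subset.Properties
  using (_∈?_; ⊥⊆; ∣⊥∣≡0; p⊆q⇒∣p∣≤∣q∣; p∩q⊆p; p∩q⊆q; x∈p∩q⁺; x∈p∩q⁻; x∈p∪q⁻; x∈∁p⇒x∉p;
         x∈p∧x≢y⇒x∈p-y; x∈p⇒∣p-x∣<∣p∣; nonempty?; Empty-unique)
open import Data.List using (List; []; _∷_; map; _++_; filter)
open import Data.List.Membership.Propositional using () renaming (_∈_ to _∈ₗ_)
open import Data.List.Membership.Propositional.Properties using (∈-map⁺; ∈-++⁺ˡ; ∈-++⁺ʳ; ∈-filter⁺)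
import Data.List.Relation.Unary.All as All
open import Data.List.Relation.Unary.All.Properties using (all-filter)
import Data.List.Relation.Unary.Any as Any
open import Data.Nat
open import Data.Nat.DivMod
open import Data.Nat.Properties
open import Algebra.Properties.CommutativeSemigroup +-commutativeSemigroup using (x∙yz≈y∙xz; xy∙z≈xz∙y)
open import Data.Nat.Tactic.RingSolver using (solve-∀)
open import Data.Product using (Σ; _×_; _,_; proj₁; proj₂; ∃-syntax; ∃₂)
open import Data.Sum using (_⊎_; inj₁; inj₂; [_,_])
open import Data.Vec using ([]; _∷_; tabulate; here; there)
open import Data.Vec.Properties using (lookup∘tabulate; lookup⇒[]=; []=⇒lookup)
open import Defs
open import Function using (_∘_; Injective; Equivalence)
open import Relation.Binary.PropositionalEquality
  using (_≡_; _≢_; refl; sym; trans; cong; cong₂; subst; module ≡-Reasoning)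
open import Relation.Nullary using (yes; no; ¬_; ¬?; contradiction)
open import Relation.Nullary.Decidable using (_×-dec_)
open import Relation.Unary using (Decidable)

Disjoint : ∀ {n} → Subset n → Subset n → Set
Disjoint p q = ∀ {v} → v ∈ p → v ∉ q

subsetSum-const : ∀ {n} (s : Subset n) {w : Fin n → ℕ} {W : ℕ} →
                  (∀ {v} → v ∈ s → w v ≡ W) → subsetSum s w ≡ ∣ s ∣ * W
subsetSum-const []          h = refl
subsetSum-const (true ∷ s)  h = cong₂ _+_ (h here) (subsetSum-const s (h ∘ there))
subsetSum-const (false ∷ s) h = subsetSum-const s (h ∘ there)

subsetSum-∪ : ∀ {n} {p q : Subset n} → Disjoint p q → (w : Fin n → ℕ) →
              subsetSum (p ∪ q) w ≡ subsetSum p w + subsetSum q w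
subsetSum-∪ {p = []}        {[]}        _ w = refl
subsetSum-∪ {p = true ∷ p}  {true ∷ q}  d w = ⊥-elim (d here here)
subsetSum-∪ {p = true ∷ p}  {false ∷ q} d w =
  trans (cong (w fzero +_) (subsetSum-∪ (λ h → d (there h) ∘ there) _)) (sym (+-assoc (w fzero) _ _))
subsetSum-∪ {p = false ∷ p} {true ∷ q}  d w =
  trans (cong (w fzero +_) (subsetSum-∪ (λ h → d (there h) ∘ there) _)) (x∙yz≈y∙xz (w fzero) (subsetSum p _) (subsetSum q _))
subsetSum-∪ {p = false ∷ p} {false ∷ q} d w = subsetSum-∪ (λ h → d (there h) ∘ there) _

∣p∪q∣≡∣p∣+∣q∣ : ∀ {n} {p q : Subset n} → Disjoint p q → ∣ p ∪ q ∣ ≡ ∣ p ∣ + ∣ q ∣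
∣p∪q∣≡∣p∣+∣q∣ {p = p} {q} p∩q=∅ = begin
  ∣ p ∪ q ∣                                        ≡⟨ ∣p∣≡subsetSum1 (p ∪ q) ⟩
  subsetSum (p ∪ q) (λ _ → 1)                      ≡⟨ subsetSum-∪ p∩q=∅ _ ⟩
  subsetSum p (λ _ → 1) + subsetSum q (λ _ → 1)    ≡⟨ sym (cong₂ _+_ (∣p∣≡subsetSum1 p) (∣p∣≡subsetSum1 q)) ⟩
  ∣ p ∣ + ∣ q ∣                                    ∎
  where
  open ≡-Reasoning
  ∣p∣≡subsetSum1 : ∀ s → ∣ s ∣ ≡ subsetSum s (λ _ → 1)
  ∣p∣≡subsetSum1 s = sym (trans (subsetSum-const s (λ _ → refl)) (*-identityʳ ∣ s ∣))

first : ∀ {n} → ℕ → Subset n → Subset n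
first zero    s           = ⊥
first (suc a) []          = []
first (suc a) (true ∷ s)  = true ∷ first a s
first (suc a) (false ∷ s) = false ∷ first (suc a) s

first-⊆ : ∀ {n} a (s : Subset n) → first a s ⊆ s
first-⊆ zero    s           h         = ⊥⊆ h
first-⊆ (suc a) (true ∷ s)  here      = here
first-⊆ (suc a) (true ∷ s)  (there h) = there (first-⊆ a s h)
first-⊆ (suc a) (false ∷ s) (there h) = there (first-⊆ (suc a) s h)

∣first∣ : ∀ {n} a (s : Subset n) → a ≤ ∣ s ∣ → ∣ first a s ∣ ≡ a
∣first∣ {n} zero    s           _  = ∣⊥∣≡0 n
∣first∣     (suc a) (true ∷ s)  a≤ = cong suc (∣first∣ a s (s≤s⁻¹ a≤))
∣first∣     (suc a) (false ∷ s) a≤ = ∣first∣ (suc a) s a≤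

∣p∣≡∣p∩q∣+∣p∩∁q∣ : ∀ {n} (p q : Subset n) → ∣ p ∣ ≡ ∣ p ∩ q ∣ + ∣ p ∩ ∁ q ∣
∣p∣≡∣p∩q∣+∣p∩∁q∣ []          []          = refl
∣p∣≡∣p∩q∣+∣p∩∁q∣ (true ∷ p)  (true ∷ q)  = cong suc (∣p∣≡∣p∩q∣+∣p∩∁q∣ p q)
∣p∣≡∣p∩q∣+∣p∩∁q∣ (true ∷ p)  (false ∷ q) = trans (cong suc (∣p∣≡∣p∩q∣+∣p∩∁q∣ p q)) (sym (+-suc _ _))
∣p∣≡∣p∩q∣+∣p∩∁q∣ (false ∷ p) (_ ∷ q)     = ∣p∣≡∣p∩q∣+∣p∩∁q∣ p q

0<∣p∣⇒Nonempty : ∀ {n} (p : Subset n) → 0 < ∣ p ∣ → Nonempty p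
0<∣p∣⇒Nonempty {n} p 0<∣p∣ with nonempty? p
... | yes ne = ne
... | no ¬ne = contradiction (trans (cong ∣_∣ (Empty-unique ¬ne)) (∣⊥∣≡0 n)) (>⇒≢ 0<∣p∣)

injective⇒k≤∣p∣ : ∀ {k n} {p : Subset n} (g : Fin k → Fin n) →
                  Injective _≡_ _≡_ g → (∀ i → g i ∈ p) → k ≤ ∣ p ∣
injective⇒k≤∣p∣ {zero}          g inj g∈p = z≤n
injective⇒k≤∣p∣ {suc k} {p = p} g inj g∈p =
  ≤-<-trans (injective⇒k≤∣p∣ {p = p - g fzero} (g ∘ fsuc) (Finₚ.suc-injective ∘ inj) g∘suc∈p-g0)
            (x∈p⇒∣p-x∣<∣p∣ (g∈p fzero))
  where
  g∘suc∈p-g0 : ∀ i → g (fsuc i) ∈ p - g fzero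
  g∘suc∈p-g0 i = x∈p∧x≢y⇒x∈p-y (g∈p (fsuc i)) (Finₚ.0≢1+n ∘ sym ∘ inj)

fibre : ∀ {n} → (Fin n → ℕ) → ℕ → Subset n
fibre f j = tabulate (λ v → f v ≡ᵇ j)

∈-fibre⁺ : ∀ {n} {f : Fin n → ℕ} {j v} → f v ≡ j → v ∈ fibre f j
∈-fibre⁺ {f = f} {j} {v} fv≡j =
  lookup⇒[]= v _ (trans (lookup∘tabulate _ v) (Equivalence.to T-≡ (≡⇒≡ᵇ (f v) j fv≡j)))

∈-fibre⁻ : ∀ {n} {f : Fin n → ℕ} {j v} → v ∈ fibre f j → f v ≡ j
∈-fibre⁻ {f = f} {j} {v} v∈ =
  ≡ᵇ⇒≡ (f v) j (Equivalence.from T-≡ (trans (sym (lookup∘tabulate _ v)) ([]=⇒lookup v∈)))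

fibre-disjoint : ∀ {n} {f : Fin n → ℕ} {j j′} → j ≢ j′ → Disjoint (fibre f j) (fibre f j′)
fibre-disjoint {f = f} j≢j′ v∈j v∈j′ = j≢j′ (trans (sym (∈-fibre⁻ {f = f} v∈j)) (∈-fibre⁻ {f = f} v∈j′))

-- Colors are natural numbers bounded on s, so that removing the top color class leaves a
-- coloring of the same kind.
fibre-pigeonhole : ∀ {n} r m (c : Fin n → ℕ) (s : Subset n) → (∀ {v} → v ∈ s → c v ≤ m) →
                   suc m * r ≤ ∣ s ∣ → ∃[ j ] j ≤ m × r ≤ ∣ s ∩ fibre c j ∣
fibre-pigeonhole r zero c s c≤0 r≤∣s∣ =
  0 , z≤n , ≤-trans (≤-trans (≤-reflexive (sym (+-identityʳ r))) r≤∣s∣) (p⊆q⇒∣p∣≤∣q∣ s⊆c⁻¹0)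
  where
  s⊆c⁻¹0 : s ⊆ s ∩ fibre c 0
  s⊆c⁻¹0 v∈s = x∈p∩q⁺ (v∈s , ∈-fibre⁺ {f = c} (n≤0⇒n≡0 (c≤0 v∈s)))
fibre-pigeonhole r (suc m) c s c≤ r≤∣s∣ with r ≤? ∣ s ∩ fibre c (suc m) ∣
... | yes r≤ = suc m , ≤-refl , r≤
... | no r≰ with fibre-pigeonhole r m c rest c≤m (+-cancelˡ-≤ r _ _ big)
  where
  rest = s ∩ ∁ (fibre c (suc m))
  c≤m : ∀ {v} → v ∈ rest → c v ≤ m
  c≤m v∈ with x∈p∩q⁻ s _ v∈
  ... | v∈s , v∉ = s≤s⁻¹ (≤∧≢⇒< (c≤ v∈s) (x∈∁p⇒x∉p v∉ ∘ ∈-fibre⁺ {f = c}))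
  big : r + suc m * r ≤ r + ∣ rest ∣
  big = ≤-trans r≤∣s∣ (≤-trans (≤-reflexive (∣p∣≡∣p∩q∣+∣p∩∁q∣ s (fibre c (suc m))))
                               (+-monoˡ-≤ ∣ rest ∣ (<⇒≤ (≰⇒> r≰))))
... | j , j≤m , r≤∣rest∩j∣ =
  j , m≤n⇒m≤1+n j≤m ,
  ≤-trans r≤∣rest∩j∣ (p⊆q⇒∣p∣≤∣q∣ λ v∈ → let v∈rest , v∈j = x∈p∩q⁻ _ _ v∈ in
                                          x∈p∩q⁺ (proj₁ (x∈p∩q⁻ s _ v∈rest) , v∈j))

residue : ∀ {n} P .{{_ : NonZero P}} → Fin n → Fin P
residue P v = toℕ v mod P

residueClass : ∀ {n} P .{{_ : NonZero P}} → ℕ → Subset n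
residueClass P = fibre (toℕ ∘ residue P)

residueClass-size : ∀ {n} P K .{{_ : NonZero P}} → P * K ≤ n →
                    ∀ {k} → k < P → K ≤ ∣ residueClass {n} P k ∣
residueClass-size {n} P K PK≤n {k} k<P = injective⇒k≤∣p∣ g g-injective g∈class
  where
  g-bound : (i : Fin K) → k + toℕ i * P < n
  g-bound i = <-≤-trans (+-monoˡ-< (toℕ i * P) k<P)
                        (≤-trans (*-monoˡ-≤ P (Finₚ.toℕ<n i)) (≤-trans (≤-reflexive (*-comm K P)) PK≤n))
  g : Fin K → Fin n
  g i = fromℕ< (g-bound i)
  g-injective : Injective _≡_ _≡_ g
  g-injective {i} {j} gi≡gj = Finₚ.toℕ-injective (*-cancelʳ-≡ _ _ P (+-cancelˡ-≡ k _ _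
    (trans (sym (Finₚ.toℕ-fromℕ< (g-bound i))) (trans (cong toℕ gi≡gj) (Finₚ.toℕ-fromℕ< (g-bound j))))))
  open ≡-Reasoning
  g∈class : ∀ i → g i ∈ residueClass P k
  g∈class i = ∈-fibre⁺ {f = toℕ ∘ residue P} (begin
    toℕ (toℕ (g i) mod P)   ≡⟨ Finₚ.toℕ-fromℕ< _ ⟩
    toℕ (g i) % P           ≡⟨ cong (_% P) (Finₚ.toℕ-fromℕ< (g-bound i)) ⟩
    (k + toℕ i * P) % P     ≡⟨ [m+kn]%n≡m%n k (toℕ i) P ⟩
    k % P                   ≡⟨ m<n⇒m%n≡m k<P ⟩
    k                       ∎)

even⊎odd : ∀ d → ∃[ e ] (d ≡ 2 * e ⊎ d ≡ suc (2 * e))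
even⊎odd zero    = 0 , inj₁ refl
even⊎odd (suc d) with even⊎odd d
... | e , inj₁ refl = e , inj₂ refl
... | e , inj₂ refl = suc e , inj₁ (cong suc (sym (+-suc e (e + 0))))

scale-to-half : ∀ q d → 0 < d → d < 2 ^ suc q →
                ∃₂ λ a u → a ≤ 2 ^ q × a * d ≡ 2 ^ q + u * 2 ^ suc q
scale-to-half q d 0<d d<2^q+1 with even⊎odd d
... | e , inj₂ refl = 2 ^ q , e , ≤-refl , odd-identity (2 ^ q) e
  where
  odd-identity : ∀ x e → x * suc (2 * e) ≡ x + e * (2 * x)
  odd-identity = solve-∀
... | e , inj₁ refl = halve q (*-cancelˡ-< 2 0 e 0<d) (*-cancelˡ-< 2 e (2 ^ q) d<2^q+1)
  where
  halve : ∀ p → 0 < e → e < 2 ^ p → ∃₂ λ a u → a ≤ 2 ^ p × a * (2 * e) ≡ 2 ^ p + u * 2 ^ suc p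
  halve zero    0<e e<1 = contradiction 0<e (<⇒≱ e<1)
  halve (suc p) 0<e e<2^p+1 with scale-to-half p e 0<e e<2^p+1
  ... | a , u , a≤2^p , ae≡ = a , u , ≤-trans a≤2^p (m≤m+n (2 ^ p) _) , (begin
    a * (2 * e)                      ≡⟨ double-right a e ⟩
    2 * (a * e)                      ≡⟨ cong (2 *_) ae≡ ⟩
    2 * (2 ^ p + u * 2 ^ suc p)      ≡⟨ double-residue (2 ^ p) u ⟩
    2 ^ suc p + u * 2 ^ suc (suc p)  ∎)
    where
    open ≡-Reasoning
    double-right : ∀ a e → a * (2 * e) ≡ 2 * (a * e)
    double-right = solve-∀
    double-residue : ∀ x u → 2 * (x + u * (2 * x)) ≡ 2 * x + u * (2 * (2 * x))
    double-residue = solve-∀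

allSubsets : ∀ n → List (Subset n)
allSubsets zero    = [] ∷ []
allSubsets (suc n) = map (true ∷_) (allSubsets n) ++ map (false ∷_) (allSubsets n)

∈-allSubsets : ∀ {n} (s : Subset n) → s ∈ₗ allSubsets n
∈-allSubsets []                  = Any.here refl
∈-allSubsets {suc n} (true ∷ s)  = ∈-++⁺ˡ (∈-map⁺ (true ∷_) (∈-allSubsets s))
∈-allSubsets {suc n} (false ∷ s) = ∈-++⁺ʳ (map (true ∷_) (allSubsets n)) (∈-map⁺ (false ∷_) (∈-allSubsets s))

%≡%⇒CongMod : ∀ a b r .{{_ : NonZero r}} → a % r ≡ b % r → CongMod a b r
%≡%⇒CongMod a b r a%r≡b%r = b / r , a / r , (begin
  a + b / r * r                  ≡⟨ cong (_+ b / r * r) (m≡m%n+[m/n]*n a r) ⟩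
  a % r + a / r * r + b / r * r  ≡⟨ xy∙z≈xz∙y (a % r) (a / r * r) (b / r * r) ⟩
  a % r + b / r * r + a / r * r  ≡⟨ cong (λ x → x + b / r * r + a / r * r) a%r≡b%r ⟩
  b % r + b / r * r + a / r * r  ≡⟨ cong (_+ a / r * r) (sym (m≡m%n+[m/n]*n b r)) ⟩
  b + a / r * r                  ∎)
  where open ≡-Reasoning

[r/2]%r≢0 : ∀ r .{{_ : NonZero r}} → 2 ≤ r → (r / 2) % r ≢ 0
[r/2]%r≢0 r 2≤r = subst (_≢ 0) (sym (m<n⇒m%n≡m (m/n<m r 2 ≤-refl))) (>⇒≢ (m≥n⇒m/n>0 2≤r))

module OddGraph {r n : ℕ} .{{_ : NonZero r}} (φ : Fin n → Fin r) where

  weight : Fin n → ℕ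
  weight v = suc (toℕ (φ v))

  IsOddEdge : Subset n → Set
  IsOddEdge e = ∣ e ∣ ≡ r × subsetSum e weight % r ≡ (r / 2) % r

  isOddEdge? : Decidable IsOddEdge
  isOddEdge? e = (∣ e ∣ ≟ r) ×-dec (subsetSum e weight % r ≟ (r / 2) % r)

  oddGraph : Graph r n
  oddGraph = record { edges = filter isOddEdge? (allSubsets n) ; uniform = All.map proj₁ (all-filter isOddEdge? (allSubsets n)) }

  ∈-oddGraph : ∀ {e} → IsOddEdge e → e ∈ₗ edges oddGraph
  ∈-oddGraph = ∈-filter⁺ isOddEdge? (∈-allSubsets _)

  oddGraph-oddColorable : OddColorable oddGraph
  oddGraph-oddColorable = φ , All.map (%≡%⇒CongMod _ _ r ∘ proj₂) (all-filter isOddEdge? (allSubsets n))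

  oddGraph-colorable : ∀ {k} (c : Fin n → Fin k) → (∀ {i j} → c i ≡ c j → φ i ≡ φ j) → 2 ≤ r →
                       Colorable oddGraph k
  oddGraph-colorable c φ-factors 2≤r = c , All.map splits (all-filter isOddEdge? (allSubsets n))
    where
    splits : ∀ {e} → IsOddEdge e → ∃[ i ] ∃[ j ] (i ∈ e × j ∈ e × c i ≢ c j)
    splits {e} (∣e∣≡r , sum≡half) with 0<∣p∣⇒Nonempty e (subst (0 <_) (sym ∣e∣≡r) (≤-trans (s≤s z≤n) 2≤r))
    ... | i , i∈e with Finₚ.any? (λ j → (j ∈? e) ×-dec ¬? (c i Finₚ.≟ c j))
    ... | yes (j , j∈e , ci≢cj) = i , j , i∈e , j∈e , ci≢cj
    ... | no ¬split = contradiction (trans (sym sum≡half) sum%r≡0) ([r/2]%r≢0 r 2≤r)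
      where
      constant : ∀ {j} → j ∈ e → weight j ≡ weight i
      constant {j} j∈e with c i Finₚ.≟ c j
      ... | yes ci≡cj = cong (suc ∘ toℕ) (φ-factors (sym ci≡cj))
      ... | no ci≢cj  = ⊥-elim (¬split (j , j∈e , ci≢cj))
      sum%r≡0 : subsetSum e weight % r ≡ 0
      sum%r≡0 = trans (cong (_% r) (trans (subsetSum-const e constant) (cong (_* weight i) ∣e∣≡r)))
                      (trans (cong (_% r) (*-comm r (weight i))) (m*n%n≡0 (weight i) r))

split-off-difference : ∀ a b k d T →
  a * suc ((k + d) * T) + b * suc (k * T) ≡ (a + b) * suc (k * T) + a * d * T
split-off-difference = solve-∀

-- 2 * Q stands for P = 2 ^ suc q, which unfolds to it.
collect-half : ∀ Q T k u →
  2 * Q * T * suc (k * T) + (Q + u * (2 * Q)) * T ≡ Q * T + (suc (k * T) + u) * (2 * Q * T)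
collect-half = solve-∀

module Construction (q t n : ℕ) where

  Q P T r K : ℕ
  Q = 2 ^ q
  P = 2 ^ suc q
  T = 2 * t + 1
  r = P * T
  K = (P ∸ 1) * r

  2≤P : 2 ≤ P
  2≤P = *-monoʳ-≤ 2 (m^n>0 2 q)

  instance
    P≢0 : NonZero P
    P≢0 = m^n≢0 2 (suc q)
    T≢0 : NonZero T
    T≢0 = subst NonZero (+-comm 1 (2 * t)) _
    r≢0 : NonZero r
    r≢0 = m*n≢0 P T
    K≢0 : NonZero K
    K≢0 = m*n≢0 (P ∸ 1) r {{>-nonZero (∸-monoˡ-≤ 1 2≤P)}}

  2≤r : 2 ≤ r
  2≤r = ≤-trans 2≤P (m≤m*n P T)

  r/2≡Q*T : r / 2 ≡ Q * T
  r/2≡Q*T = trans (cong (_/ 2) (halving Q T)) (m*n/n≡m (Q * T) 2)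
    where
    halving : ∀ Q T → 2 * Q * T ≡ Q * T * 2
    halving = solve-∀

  scale : Fin P → Fin r
  scale k = fromℕ< (*-monoˡ-< T (Finₚ.toℕ<n k))

  open OddGraph {n = n} (scale ∘ residue P) public

  residue-coloring : Colorable oddGraph P
  residue-coloring = oddGraph-colorable (residue P) (cong scale) 2≤r

  weight-on-class : ∀ {k v} → v ∈ residueClass P k → weight v ≡ suc (k * T)
  weight-on-class {k} {v} v∈k =
    cong suc (trans (Finₚ.toℕ-fromℕ< _) (cong (_* T) (∈-fibre⁻ {f = toℕ ∘ residue P} v∈k)))

  weight-of-first : ∀ {k} c (X : Subset n) → X ⊆ residueClass P k → c ≤ ∣ X ∣ →
                    subsetSum (first c X) weight ≡ c * suc (k * T)
  weight-of-first {k} c X X⊆k c≤∣X∣ =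
    trans (subsetSum-const _ (weight-on-class ∘ X⊆k ∘ first-⊆ c X)) (cong (_* suc (k * T)) (∣first∣ c X c≤∣X∣))

  two-class-weight : ∀ {u} a b k₁ k₂ → k₁ ≤ k₂ → a + b ≡ r → a * (k₂ ∸ k₁) ≡ Q + u * P →
                     a * suc (k₂ * T) + b * suc (k₁ * T) ≡ Q * T + (suc (k₁ * T) + u) * r
  two-class-weight {u} a b k₁ k₂ k₁≤k₂ a+b≡r a*d≡ = begin
    a * suc (k₂ * T) + b * suc (k₁ * T)
      ≡⟨ cong (λ k → a * suc (k * T) + b * suc (k₁ * T)) (sym (m+[n∸m]≡n k₁≤k₂)) ⟩
    a * suc ((k₁ + (k₂ ∸ k₁)) * T) + b * suc (k₁ * T)
      ≡⟨ split-off-difference a b k₁ (k₂ ∸ k₁) T ⟩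
    (a + b) * suc (k₁ * T) + a * (k₂ ∸ k₁) * T
      ≡⟨ cong₂ _+_ (cong (_* suc (k₁ * T)) a+b≡r) (cong (_* T) a*d≡) ⟩
    r * suc (k₁ * T) + (Q + u * P) * T
      ≡⟨ collect-half Q T k₁ u ⟩
    Q * T + (suc (k₁ * T) + u) * r
      ∎
    where open ≡-Reasoning

  two-classes-span-edge : ∀ {k₁ k₂} → k₁ < k₂ → k₂ < P → (C : Subset n) →
                          r ≤ ∣ residueClass P k₁ ∩ C ∣ → r ≤ ∣ residueClass P k₂ ∩ C ∣ →
                          ∃[ e ] e ∈ₗ edges oddGraph × e ⊆ C
  two-classes-span-edge {k₁} {k₂} k₁<k₂ k₂<P C r≤∣B∣ r≤∣A∣
    with scale-to-half q (k₂ ∸ k₁) (m<n⇒0<n∸m k₁<k₂) (≤-<-trans (m∸n≤m k₂ k₁) k₂<P)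
  ... | a , u , a≤Q , a*d≡ = S , ∈-oddGraph (∣S∣≡r , weight-sum≡half) , S⊆C
    where
    A B : Subset n
    A = residueClass P k₂ ∩ C
    B = residueClass P k₁ ∩ C
    a≤r : a ≤ r
    a≤r = ≤-trans a≤Q (≤-trans (m≤m+n Q (Q + 0)) (m≤m*n P T))
    b = r ∸ a
    a+b≡r : a + b ≡ r
    a+b≡r = m+[n∸m]≡n a≤r
    a≤∣A∣ : a ≤ ∣ A ∣
    a≤∣A∣ = ≤-trans a≤r r≤∣A∣
    b≤∣B∣ : b ≤ ∣ B ∣
    b≤∣B∣ = ≤-trans (m∸n≤m r a) r≤∣B∣
    S = first a A ∪ first b B
    disjoint : Disjoint (first a A) (first b B)
    disjoint v∈A v∈B = fibre-disjoint {f = toℕ ∘ residue P} (>⇒≢ k₁<k₂)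
      (p∩q⊆p _ _ (first-⊆ a A v∈A)) (p∩q⊆p _ _ (first-⊆ b B v∈B))
    S⊆C : S ⊆ C
    S⊆C v∈S = [ p∩q⊆q _ _ ∘ first-⊆ a A , p∩q⊆q _ _ ∘ first-⊆ b B ] (x∈p∪q⁻ _ _ v∈S)
    ∣S∣≡r : ∣ S ∣ ≡ r
    ∣S∣≡r = trans (∣p∪q∣≡∣p∣+∣q∣ disjoint) (trans (cong₂ _+_ (∣first∣ a A a≤∣A∣) (∣first∣ b B b≤∣B∣)) a+b≡r)
    open ≡-Reasoning
    weight-sum≡half : subsetSum S weight % r ≡ (r / 2) % r
    weight-sum≡half = begin
      subsetSum S weight % r
        ≡⟨ cong (_% r) (subsetSum-∪ disjoint weight) ⟩
      (subsetSum (first a A) weight + subsetSum (first b B) weight) % r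
        ≡⟨ cong (_% r) (cong₂ _+_ (weight-of-first a A (p∩q⊆p _ _) a≤∣A∣) (weight-of-first b B (p∩q⊆p _ _) b≤∣B∣)) ⟩
      (a * suc (k₂ * T) + b * suc (k₁ * T)) % r
        ≡⟨ cong (_% r) (two-class-weight a b k₁ k₂ (<⇒≤ k₁<k₂) a+b≡r a*d≡) ⟩
      (Q * T + (suc (k₁ * T) + u) * r) % r
        ≡⟨ [m+kn]%n≡m%n (Q * T) (suc (k₁ * T) + u) r ⟩
      (Q * T) % r
        ≡⟨ cong (_% r) (sym r/2≡Q*T) ⟩
      (r / 2) % r
        ∎

  module _ (PK≤n : P * K ≤ n) where

    module _ {m} (m+1<P : suc m < P) (c : Fin n → Fin (suc m)) where

      color : Fin n → ℕ
      color = toℕ ∘ c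

      popular : (k : Fin P) → ∃[ j ] j ≤ m × r ≤ ∣ residueClass P (toℕ k) ∩ fibre color j ∣
      popular k = fibre-pigeonhole r m color (residueClass P (toℕ k)) (λ {v} _ → s≤s⁻¹ (Finₚ.toℕ<n (c v)))
        (≤-trans (*-monoˡ-≤ r (∸-monoˡ-≤ 1 m+1<P)) (residueClass-size {n} P K PK≤n (Finₚ.toℕ<n k)))

      popularColor : Fin P → Fin (suc m)
      popularColor k = fromℕ< (s≤s (proj₁ (proj₂ (popular k))))

      edge-from-collision : ∀ {k₁ k₂} → toℕ k₁ < toℕ k₂ → popularColor k₁ ≡ popularColor k₂ →
                            ∃[ j ] ∃[ e ] e ∈ₗ edges oddGraph × e ⊆ fibre color j
      edge-from-collision {k₁} {k₂} k₁<k₂ same =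
        j₁ , two-classes-span-edge k₁<k₂ (Finₚ.toℕ<n k₂) (fibre color j₁) (proj₂ (proj₂ (popular k₁)))
               (subst (λ j → r ≤ ∣ residueClass P (toℕ k₂) ∩ fibre color j ∣) j₂≡j₁ (proj₂ (proj₂ (popular k₂))))
        where
        j₁ = proj₁ (popular k₁)
        j₂≡j₁ : proj₁ (popular k₂) ≡ j₁
        j₂≡j₁ = trans (sym (Finₚ.toℕ-fromℕ< (s≤s (proj₁ (proj₂ (popular k₂))))))
                (trans (cong toℕ (sym same)) (Finₚ.toℕ-fromℕ< (s≤s (proj₁ (proj₂ (popular k₁))))))

      monochromatic-edge : ∃[ j ] ∃[ e ] e ∈ₗ edges oddGraph × e ⊆ fibre color j
      monochromatic-edge with Finₚ.pigeonhole m+1<P popularColor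
      ... | k₁ , k₂ , k₁<k₂ , same = edge-from-collision k₁<k₂ same

    vertex : Fin n
    vertex = fromℕ< (≤-trans (>-nonZero⁻¹ (P * K) {{m*n≢0 P K}}) PK≤n)

    not-colorable : ∀ m → m < P → ¬ Colorable oddGraph m
    not-colorable zero    _     (c , _) with c vertex
    ... | ()
    not-colorable (suc m) m+1<P (c , splits) =
      let j , e , e∈G , e⊆j = monochromatic-edge m+1<P c
          i , i′ , i∈e , i′∈e , ci≢ci′ = All.lookup splits e∈G
      in ci≢ci′ (Finₚ.toℕ-injective (trans (∈-fibre⁻ {f = toℕ ∘ c} (e⊆j i∈e)) (sym (∈-fibre⁻ {f = toℕ ∘ c} (e⊆j i′∈e)))))

mainTheorem2 : (q t : ℕ) → q ≥ 1 →
    let r = 2 ^ q * (2 * t + 1) in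
    (n : ℕ) → n ≥ 2 ^ q * (2 ^ q ∸ 1) * r →
    Σ (Graph r n) λ G → OddColorable G × ChromaticNumber G (2 ^ q)
mainTheorem2 (suc q) t _ n n≥ =
  oddGraph , oddGraph-oddColorable , residue-coloring ,
  not-colorable (≤-trans (≤-reflexive (sym (*-assoc P (P ∸ 1) r))) n≥)
  where open Construction q t n
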